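{- Let $m$ be a positive integer and let $L$ be a list assignment on a path $P=v_1\cdots v_n$ with $n$ odd and $|L(v_i)|=4m$ for all $i$. Then $S_L(P)\ge 2nm+2m$.
   Context: $X_1=L(v_1)$, $X_i=L(v_i)\setminus X_{i-1}$ for $i>1$, and $S_L(P)=\sum_{i=1}^n|X_i|$. -}

module Defs where

open import Data.Nat using (ℕ; zero; suc; _+_; _≟_)
open import Data.List using (List; []; _∷_; length; filter)
open import Data.List.Membership.DecPropositional _≟_ using (_∉?_)
open import Data.Fin using (Fin)
open import Data.Vec using (Vec; tabulate; toList)

-- Colours are natural numbers; a list (of colours) at a vertex is a
-- duplicate-free List ℕ, viewed as a finite set.

_∖_ : List ℕ → List ℕ → List ℕ
A ∖ B = filter (_∉? B) A

-- Given the previous set X_{i-1} and the remaining lists L(v_i), L(v_{i+1}), ...,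
-- compute Σ |X_j| with X_i = L(v_i) ∖ X_{i-1}.
S-from : List ℕ → List (List ℕ) → ℕ
S-from prev [] = 0
S-from prev (A ∷ As) = length (A ∖ prev) + S-from (A ∖ prev) As

-- S_L(P) for the path v_1 ⋯ v_n given as the sequence L(v_1), ..., L(v_n).
-- X_1 = L(v_1) = L(v_1) ∖ ∅.
S-seq : List (List ℕ) → ℕ
S-seq Ls = S-from [] Ls

S : (n : ℕ) → (Fin n → List ℕ) → ℕ
S n L = S-seq (toList (tabulate L))

module Submission where

open import Defs
open import Data.Nat using (ℕ; suc; zero; _+_; _*_; _≤_; _≥_; z≤n; s≤s; _≟_)
open import Data.Nat.Properties
  using (≤-reflexive; ≤-trans; +-monoʳ-≤; +-mono-≤; +-comm; +-identityʳ; +-suc; +-assoc; suc-injective; module ≤-Reasoning)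
open import Data.Nat.Tactic.RingSolver using (solve-∀)
open import Data.Fin using (Fin)
open import Data.List using (List; length; []; _∷_; filter)
open import Data.List.Properties using (filter-notAll)
open import Data.List.Relation.Unary.All as All using (All; []; _∷_)
import Data.List.Relation.Unary.Any as Any
open import Data.List.Relation.Unary.AllPairs using (_∷_)
open import Data.List.Relation.Unary.Unique.Propositional using (Unique)
import Data.List.Relation.Unary.Unique.Propositional.Properties as Unique
open import Data.List.Relation.Binary.Subset.Propositional using (_⊆_)
open import Data.List.Membership.Propositional.Properties using (∈-filter⁺; ∈-filter⁻)
open import Data.List.Membership.DecPropositional _≟_ using (_∈?_)
open import Data.Vec using (tabulate; toList)
open import Data.Vec.Properties using (length-toList)
import Data.Vec.Relation.Unary.All.Properties as VecAll
open import Data.Product using (_×_; _,_; proj₂)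
open import Relation.Nullary using (Dec; yes; no; ¬_; ¬?)
open import Relation.Binary.PropositionalEquality using (_≡_; refl; sym; trans; cong; subst)

-- For a duplicate-free list A and any B, |A| ≤ |A ∖ B| + |B|, since A ∩ B ⊆ B.
-- Applied to X_{i+1} = L(v_{i+1}) ∖ X_i this gives |X_i| + |X_{i+1}| ≥ |L(v_{i+1})| = 4m,
-- so the n = 2k + 1 summands of S_L(P) split into X_1, of size 4m, and k pairs, each of
-- total size at least 4m: S_L(P) ≥ 4m(k + 1) = 2nm + 2m.

Unique⇒length-≤ : ∀ {xs ys : List ℕ} → Unique xs → xs ⊆ ys → length xs ≤ length ys
Unique⇒length-≤ {[]}     _            _    = z≤n
Unique⇒length-≤ {x ∷ xs} {ys} (x∉xs ∷ u) x∷xs⊆ys =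
  ≤-trans (s≤s (Unique⇒length-≤ u xs⊆ys-x))
          (filter-notAll ≢x? ys (Any.map (λ x≡y y≢x → y≢x (sym x≡y)) (x∷xs⊆ys (Any.here refl))))
  where
  ≢x? : (y : ℕ) → Dec (¬ y ≡ x)
  ≢x? y = ¬? (y ≟ x)
  xs⊆ys-x : xs ⊆ filter ≢x? ys
  xs⊆ys-x y∈xs = ∈-filter⁺ ≢x? (x∷xs⊆ys (Any.there y∈xs)) (λ y≡x → All.lookup x∉xs y∈xs (sym y≡x))

length-≡-∖-+-∩ : ∀ (A B : List ℕ) → length A ≡ length (A ∖ B) + length (filter (_∈? B) A)
length-≡-∖-+-∩ []      B = refl
length-≡-∖-+-∩ (x ∷ A) B with x ∈? B
... | yes _ = trans (cong suc (length-≡-∖-+-∩ A B)) (sym (+-suc _ _))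
... | no  _ = cong suc (length-≡-∖-+-∩ A B)

length-≤-∖-+ : ∀ {A : List ℕ} (B : List ℕ) → Unique A → length A ≤ length (A ∖ B) + length B
length-≤-∖-+ {A} B u = subst (_≤ length (A ∖ B) + length B) (sym (length-≡-∖-+-∩ A B))
  (+-monoʳ-≤ (length (A ∖ B))
    (Unique⇒length-≤ (Unique.filter⁺ (_∈? B) u) (λ x∈A∩B → proj₂ (∈-filter⁻ (_∈? B) {xs = A} x∈A∩B))))

module _ (c : ℕ) where

  Large : List ℕ → Set
  Large A = Unique A × c ≤ length A

  S-from-even : ∀ k prev (As : List (List ℕ)) → length As ≡ k + k → All Large As
              → k * c ≤ S-from prev As
  S-from-even zero    prev []           _ _ = z≤n
  S-from-even (suc k) prev (A ∷ []) e _ with () ← trans (suc-injective e) (+-suc k k)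
  S-from-even (suc k) prev (A ∷ B ∷ As) e (_ ∷ (uB , c≤|B|) ∷ large) = begin
    c + k * c                 ≤⟨ +-mono-≤ pair ih ⟩
    (|X| + |Y|) + S-from Y As ≡⟨ +-assoc |X| |Y| _ ⟩
    S-from prev (A ∷ B ∷ As)  ∎
    where
    open ≤-Reasoning
    X Y : List ℕ
    X = A ∖ prev
    Y = B ∖ X
    |X| |Y| : ℕ
    |X| = length X
    |Y| = length Y
    pair : c ≤ |X| + |Y|
    pair = ≤-trans c≤|B| (subst (length B ≤_) (+-comm |Y| |X|) (length-≤-∖-+ X uB))
    ih : k * c ≤ S-from Y As
    ih = S-from-even k Y As (suc-injective (trans (suc-injective e) (+-suc k k))) large

  S-seq-odd : ∀ k (As : List (List ℕ)) → length As ≡ suc (k + k) → All Large As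
            → suc k * c ≤ S-seq As
  S-seq-odd k (A ∷ As) e ((uA , c≤|A|) ∷ large) =
    +-mono-≤ (≤-trans c≤|A| (subst (length A ≤_) (+-identityʳ (length (A ∖ []))) (length-≤-∖-+ [] uA)))
             (S-from-even k (A ∖ []) As (suc-injective e) large)

lemma3p3 : (m n k : ℕ) → 1 ≤ m → n ≡ 2 * k + 1
    → (L : Fin n → List ℕ)
    → (∀ i → Unique (L i))
    → (∀ i → length (L i) ≡ 4 * m)
    → S n L ≥ 2 * n * m + 2 * m
lemma3p3 m .(2 * k + 1) k _ refl L unique size =
  subst (_≤ S (2 * k + 1) L) (sym (bound≡ m k))
    (S-seq-odd (4 * m) k (toList (tabulate L))
      (trans (length-toList (tabulate L)) (n≡ k))
      (VecAll.toList⁺ (VecAll.tabulate⁺ (λ i → unique i , ≤-reflexive (sym (size i))))))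
  where
  bound≡ : ∀ m k → 2 * (2 * k + 1) * m + 2 * m ≡ suc k * (4 * m)
  bound≡ = solve-∀
  n≡ : ∀ k → 2 * k + 1 ≡ suc (k + k)
  n≡ = solve-∀
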